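{- Consider the multi-level weighted additive spanner problem with input a weighted graph $G=(V,E)$ with maximum edge weight $W$, nested terminal sets $S_\ell\subseteq\dots\subseteq S_1\subseteq V$, and $c\ge 0$. Let $\mathrm{OPT}$ be the minimum sparsity of a multi-level additive spanner for this input. Run the following rounding-up approach: for each $v\in S_1$ let $P(v)=\max\{i: v\in S_i\}$ and round $P(v)$ up to the nearest power of $2$, obtaining $P'(v)$. For each $i\in\{1,2,4,\dots,2^{\lceil\log_2\ell\rceil}\}$, compute a subsetwise $+cW$ spanner $H_i$ of $G$ over $\{v\in S_1: P'(v)\ge i\}$ having the minimum possible number of edges. Output the multi-level spanner obtained by taking the union of the $H_i$, keeping each edge at the highest level $i$ it appears in (so the level-$j$ subgraph is $G_j=\bigcup_{i\ge j} H_i$, the union over powers of two $i\ge j$). Then the sparsity of the output is at most $4\cdot\mathrm{OPT}$.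
   Context: A subsetwise $+cW$ spanner of $G$ over $S\subseteq V$ is a subgraph $H$ with $\mathrm{dist}_H(u,v)\le\mathrm{dist}_G(u,v)+cW$ for all $u,v\in S$ (weighted distances). A multi-level additive spanner for input $(G, S_\ell\subseteq\dots\subseteq S_1, c)$ is a nested sequence of subgraphs $G_\ell\subseteq G_{\ell-1}\subseteq\dots\subseteq G_1\subseteq G$ such that each $G_i$ is a subsetwise $+cW$ spanner of $G$ over $S_i$. Its sparsity is $\sum_{i=1}^{\ell}|E(G_i)|$.
   Formalization: The edge weights of G and the parameter c are rational rather than real. -}

module Defs where

open import Data.Nat using (ℕ; zero; suc; _^_; _≤?_)
open import Data.Nat.Logarithm using (⌈log₂_⌉)
open import Data.Bool using (Bool; true; false; if_then_else_; _∧_)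
open import Data.Fin using (Fin)
import Data.Fin as Fin
open import Data.Fin.Subset using (Subset; ⊤; ⋃; _∈_; _⊆_; ∣_∣)
open import Data.Vec using (lookup; tabulate)
open import Data.List using (List; map; filter; upTo)
open import Data.Nat.ListAction using (sum)
open import Data.Rational using (ℚ; 0ℚ; _+_; _*_; _≤_; _<_; _⊔_)
open import Relation.Nullary.Decidable using (⌊_⌋)
open import Relation.Binary.PropositionalEquality using (_≡_; _≢_)

record WGraph : Set where
  field
    n   : ℕ
    m   : ℕ
    src : Fin m → Fin n
    tgt : Fin m → Fin n
    w   : Fin m → ℚ

open WGraph public

IsSimple : WGraph → Set
IsSimple G =
  (∀ e → src G e ≢ tgt G e) ×'
  ((∀ e e' → src G e ≡ src G e' → tgt G e ≡ tgt G e' → e ≡ e') ×'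
   (∀ e e' → src G e ≡ tgt G e' → tgt G e ≡ src G e' → e ≡ e'))
  where
  open import Data.Product using () renaming (_×_ to _×'_)

PositiveWeights : WGraph → Set
PositiveWeights G = ∀ e → 0ℚ < w G e

-- A subgraph of G is a subset of its edges (on the full vertex set).
Sub : WGraph → Set
Sub G = Subset (m G)

data Walk (G : WGraph) (H : Sub G) : Fin (n G) → Fin (n G) → Set where
  []  : ∀ {u} → Walk G H u u
  fwd : ∀ {v} (e : Fin (m G)) → e ∈ H → Walk G H (tgt G e) v → Walk G H (src G e) v
  bwd : ∀ {v} (e : Fin (m G)) → e ∈ H → Walk G H (src G e) v → Walk G H (tgt G e) v

len : ∀ {G H u v} → Walk G H u v → ℚ
len [] = 0ℚ
len {G} (fwd e _ p) = w G e + len p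
len {G} (bwd e _ p) = w G e + len p

-- Maximum edge weight W (0 if there are no edges).
maxW : WGraph → ℚ
maxW G = go (m G) (λ e → w G e)
  where
  go : (k : ℕ) → (Fin k → ℚ) → ℚ
  go zero    f = 0ℚ
  go (suc k) f = f Fin.zero ⊔ go k (λ i → f (Fin.suc i))

-- H is a subsetwise +cW spanner of G over S:
-- dist_H(u,v) ≤ dist_G(u,v) + cW for all u,v ∈ S, i.e. for every walk p
-- in G from u to v there is a walk q in H from u to v with
-- len q ≤ len p + c·W.
IsSubsetSpanner : (G : WGraph) → ℚ → Subset (n G) → Sub G → Set
IsSubsetSpanner G c S H =
  ∀ u v → u ∈ S → v ∈ S → (p : Walk G ⊤ u v) →
    Σ' (Walk G H u v) (λ q → len q ≤ len p + c * maxW G)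
  where
  open import Data.Product using () renaming (Σ to Σ')

-- Levels are indexed by ℕ; only indices 1 … ℓ are meaningful.
-- Nested terminal sets S_ℓ ⊆ … ⊆ S_1.
NestedTerminals : (G : WGraph) → ℕ → (ℕ → Subset (n G)) → Set
NestedTerminals G ℓ S = ∀ i → 1 Data.Nat.≤ i → i Data.Nat.< ℓ → S (suc i) ⊆ S i
  where import Data.Nat

IsMultiLevelSpanner : (G : WGraph) → ℕ → (ℕ → Subset (n G)) → ℚ → (ℕ → Sub G) → Set
IsMultiLevelSpanner G ℓ S c Gs =
  (∀ i → 1 Data.Nat.≤ i → i Data.Nat.< ℓ → Gs (suc i) ⊆ Gs i) ×'
  (∀ i → 1 Data.Nat.≤ i → i Data.Nat.≤ ℓ → IsSubsetSpanner G c (S i) (Gs i))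
  where
  import Data.Nat
  open import Data.Product using () renaming (_×_ to _×'_)

sparsity : (G : WGraph) → ℕ → (ℕ → Sub G) → ℕ
sparsity G ℓ Gs = sum (map (λ j → ∣ Gs (suc j) ∣) (upTo ℓ))

-- P(v) = max{ i ≤ ℓ : v ∈ S_i }  (0 if v ∉ S_1).
maxLevel : ∀ {N} → (ℕ → Subset N) → ℕ → Fin N → ℕ
maxLevel S zero    v = 0
maxLevel S (suc i) v = if lookup (S (suc i)) v then suc i else maxLevel S i v

roundUpPow2 : ℕ → ℕ
roundUpPow2 p = 2 ^ ⌈log₂ p ⌉

topExp : ℕ → ℕ
topExp ℓ = ⌈log₂ ℓ ⌉

roundedTerminals : ∀ {N} → ℕ → (ℕ → Subset N) → ℕ → Subset N
roundedTerminals ℓ S k =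
  tabulate (λ v → lookup (S 1) v ∧ ⌊ 2 ^ k ≤? roundUpPow2 (maxLevel S ℓ v) ⌋)

-- Output of the rounding-up approach, given H k (the spanner for level 2^k):
-- G_j = ⋃ { H k : 0 ≤ k ≤ K, 2^k ≥ j }.
roundedOutput : (G : WGraph) → ℕ → (ℕ → Sub G) → ℕ → Sub G
roundedOutput G ℓ H j = ⋃ (map H (filter (λ k → j ≤? 2 ^ k) (upTo (suc (topExp ℓ)))))

-- A vertex of S₁ is a terminal of the rounded level 2ᵏ only if P(v) > 2ᵏ/2, so it lies
-- in S_j for every j ≤ 2ᵏ/2 + 1, and minimality of H_k gives |H_k| ≤ |G_j| for all those
-- levels j ≤ ℓ. Since H_k enters only the output levels j ≤ 2ᵏ, the output has sparsity
-- at most Σ_k 2ᵏ|H_k|. For k ≥ 2 the 2^{k-2} levels j ∈ (2^{k-2}, 2^{k-1}] pay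
-- 4|G_j| ≥ 2ᵏ|H_k| between them, and |H₀| + 2|H₁| ≤ 3|G₁|; these blocks are disjoint
-- and lie below ℓ because 2^{⌈log₂ ℓ⌉ - 1} < ℓ.
module Submission where

open import Defs
open import Data.Nat using (ℕ; zero; suc; _+_; _*_; _^_; _≤_; _<_; _≤?_; z≤n; s≤s; z<s; NonZero; >-nonZero)
open import Data.Fin.Subset using (Subset; ∣_∣; _⊆_; _∪_; ⋃; _∈_)
open import Data.Rational using (ℚ; 0ℚ)
open import Data.Rational using () renaming (_≤_ to _≤ℚ_)
open import Data.Nat.Properties
open import Algebra.Properties.CommutativeSemigroup +-commutativeSemigroup using (interchange)
open import Data.Nat.Logarithm using (⌈log₂_⌉; ⌈log₂⌉-mono-≤; ⌈log₂2^n⌉≡n; ⌈log₂2*n⌉≡1+⌈log₂n⌉)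
open import Data.Nat.ListAction using (sum)
open import Data.Nat.Tactic.RingSolver using (solve-∀)
open import Data.Bool using (true; false; if_then_else_; _∧_)
open import Data.Bool.Properties using (∧-conicalˡ; ∧-conicalʳ; T-≡)
open import Data.Fin.Subset.Properties using (∣⊥∣≡0)
open import Data.Vec using ([]; _∷_; lookup)
open import Data.Vec.Properties using ([]=⇒lookup; lookup⇒[]=; lookup∘tabulate)
open import Data.List using (List; []; _∷_; map; filter; upTo; applyUpTo)
open import Data.List.Properties using (map-upTo; map-∘)
open import Data.Product using (_×_; _,_; proj₁; proj₂)
open import Data.Sum using (inj₁; inj₂)
open import Function using (_∘_; Equivalence)
open import Relation.Nullary using (does; contradiction)
open import Relation.Nullary.Decidable using (⌊_⌋; toWitness)
open import Relation.Unary using (Pred; Decidable)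
open import Relation.Binary.PropositionalEquality

∑ : ℕ → (ℕ → ℕ) → ℕ
∑ zero    f = 0
∑ (suc n) f = f 0 + ∑ n (f ∘ suc)

syntax ∑ n (λ i → e) = ∑[ i < n ] e

sum-applyUpTo : ∀ (f : ℕ → ℕ) n → sum (applyUpTo f n) ≡ ∑ n f
sum-applyUpTo f zero    = refl
sum-applyUpTo f (suc n) = cong (f 0 +_) (sum-applyUpTo (f ∘ suc) n)

sum-map-upTo : ∀ (f : ℕ → ℕ) n → sum (map f (upTo n)) ≡ ∑ n f
sum-map-upTo f n = trans (cong sum (map-upTo f n)) (sum-applyUpTo f n)

∑-mono-≤ : ∀ n {f g : ℕ → ℕ} → (∀ i → f i ≤ g i) → ∑ n f ≤ ∑ n g
∑-mono-≤ zero    f≤g = z≤n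
∑-mono-≤ (suc n) f≤g = +-mono-≤ (f≤g 0) (∑-mono-≤ n (f≤g ∘ suc))

∑-split : ∀ m n (f : ℕ → ℕ) → ∑ (m + n) f ≡ ∑ m f + ∑[ i < n ] f (m + i)
∑-split zero    n f = refl
∑-split (suc m) n f = trans (cong (f 0 +_) (∑-split m n (f ∘ suc))) (sym (+-assoc (f 0) _ _))

∑-init-last : ∀ n (f : ℕ → ℕ) → ∑ (suc n) f ≡ ∑ n f + f n
∑-init-last zero    f = +-comm (f 0) 0
∑-init-last (suc n) f = trans (cong (f 0 +_) (∑-init-last n (f ∘ suc))) (sym (+-assoc (f 0) _ _))

∑-mono-range : ∀ {m n} (f : ℕ → ℕ) → m ≤ n → ∑ m f ≤ ∑ n f
∑-mono-range {m} f m≤n with m≤n⇒∃[o]m+o≡n m≤n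
... | o , refl = subst (∑ m f ≤_) (sym (∑-split m o f)) (m≤m+n (∑ m f) _)

*≤∑ : ∀ n {x} (f : ℕ → ℕ) → (∀ i → i < n → x ≤ f i) → n * x ≤ ∑ n f
*≤∑ zero    f x≤f = z≤n
*≤∑ (suc n) f x≤f = +-mono-≤ (x≤f 0 z<s) (*≤∑ n (f ∘ suc) (λ i i<n → x≤f (suc i) (s≤s i<n)))

∑-zero : ∀ n → ∑[ _ < n ] 0 ≡ 0
∑-zero zero    = refl
∑-zero (suc n) = ∑-zero n

∑-distrib-+ : ∀ n (f g : ℕ → ℕ) → ∑[ i < n ] (f i + g i) ≡ ∑ n f + ∑ n g
∑-distrib-+ zero    f g = refl
∑-distrib-+ (suc n) f g = begin
  (f 0 + g 0) + ∑[ i < n ] (f (suc i) + g (suc i)) ≡⟨ cong (f 0 + g 0 +_) (∑-distrib-+ n (f ∘ suc) (g ∘ suc)) ⟩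
  (f 0 + g 0) + (∑ n (f ∘ suc) + ∑ n (g ∘ suc))    ≡⟨ interchange (f 0) (g 0) _ _ ⟩
  (f 0 + ∑ n (f ∘ suc)) + (g 0 + ∑ n (g ∘ suc))    ∎
  where open ≡-Reasoning

∑-comm : ∀ m n (f : ℕ → ℕ → ℕ) → ∑[ i < m ] ∑[ j < n ] f i j ≡ ∑[ j < n ] ∑[ i < m ] f i j
∑-comm zero    n f = sym (∑-zero n)
∑-comm (suc m) n f = trans (cong (∑ n (f 0) +_) (∑-comm m n (f ∘ suc)))
                           (sym (∑-distrib-+ n (f 0) _))

∑-indicator-≤ : ∀ n m x → ∑[ j < n ] (if does (suc j ≤? m) then x else 0) ≤ m * x
∑-indicator-≤ zero    m       x = z≤n
∑-indicator-≤ (suc n) zero    x = ∑-indicator-≤ n zero x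
∑-indicator-≤ (suc n) (suc m) x = +-monoʳ-≤ x (∑-indicator-≤ n m x)

∑-doubling-block : ∀ (h g : ℕ → ℕ) t →
  (∀ k j → k ≤ suc t → j < 2 ^ t → 2 * j ≤ 2 ^ k → h k ≤ g j) →
  ∑[ k < 2 + t ] (2 ^ k * h k) ≤ 4 * ∑ (2 ^ t) g
∑-doubling-block h g zero h≤g = begin
  1 * h 0 + (2 * h 1 + 0) ≤⟨ +-mono-≤ (*-monoʳ-≤ 1 h₀≤g₀) (+-monoˡ-≤ 0 (*-monoʳ-≤ 2 h₁≤g₀)) ⟩
  1 * g 0 + (2 * g 0 + 0) ≡⟨ regroup (g 0) ⟩
  3 * (g 0 + 0)           ≤⟨ *-monoˡ-≤ (g 0 + 0) (n≤1+n 3) ⟩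
  4 * (g 0 + 0)           ∎
  where
  open ≤-Reasoning
  h₀≤g₀ = h≤g 0 0 z≤n z<s z≤n
  h₁≤g₀ = h≤g 1 0 (s≤s z≤n) z<s z≤n
  regroup : ∀ x → 1 * x + (2 * x + 0) ≡ 3 * (x + 0)
  regroup = solve-∀
∑-doubling-block h g (suc t) h≤g = begin
  ∑[ k < 3 + t ] (2 ^ k * h k)                            ≡⟨ ∑-init-last (2 + t) (λ k → 2 ^ k * h k) ⟩
  ∑[ k < 2 + t ] (2 ^ k * h k) + 2 ^ (2 + t) * h (2 + t)  ≡⟨ cong (∑[ k < 2 + t ] (2 ^ k * h k) +_) (regroup (2 ^ t) (h (2 + t))) ⟩
  ∑[ k < 2 + t ] (2 ^ k * h k) + 4 * (2 ^ t * h (2 + t))  ≤⟨ +-mono-≤ lowerLevels (*-monoʳ-≤ 4 (*≤∑ (2 ^ t) (λ i → g (2 ^ t + i)) newLevel)) ⟩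
  4 * ∑ (2 ^ t) g + 4 * ∑[ i < 2 ^ t ] g (2 ^ t + i)    ≡⟨ sym (*-distribˡ-+ 4 (∑ (2 ^ t) g) (∑[ i < 2 ^ t ] g (2 ^ t + i))) ⟩
  4 * (∑ (2 ^ t) g + ∑[ i < 2 ^ t ] g (2 ^ t + i))      ≡⟨ cong (4 *_) (sym (∑-split (2 ^ t) (2 ^ t) g)) ⟩
  4 * ∑ (2 ^ t + 2 ^ t) g                               ≡⟨ cong (λ m → 4 * ∑ m g) (cong (2 ^ t +_) (sym (+-identityʳ (2 ^ t)))) ⟩
  4 * ∑ (2 ^ suc t) g                                   ∎
  where
  open ≤-Reasoning
  regroup : ∀ x y → 2 * (2 * x) * y ≡ 4 * (x * y)
  regroup = solve-∀
  lowerLevels : ∑[ k < 2 + t ] (2 ^ k * h k) ≤ 4 * ∑ (2 ^ t) g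
  lowerLevels = ∑-doubling-block h g t λ k j k≤1+t j<2^t →
    h≤g k j (m≤n⇒m≤1+n k≤1+t) (<-≤-trans j<2^t (^-monoʳ-≤ 2 (n≤1+n t)))
  newLevel : ∀ i → i < 2 ^ t → h (2 + t) ≤ g (2 ^ t + i)
  newLevel i i<2^t = h≤g (2 + t) (2 ^ t + i) ≤-refl j<2^[1+t] (*-monoʳ-≤ 2 (<⇒≤ j<2^[1+t]))
    where
    j<2^[1+t] : 2 ^ t + i < 2 ^ suc t
    j<2^[1+t] = +-monoʳ-< (2 ^ t) (subst (i <_) (sym (+-identityʳ (2 ^ t))) i<2^t)

∑-doubling-≤ : ∀ (h g : ℕ → ℕ) K ℓ → 2 ^ K < 2 * ℓ →
  (∀ k j → k ≤ K → j < ℓ → 2 * j ≤ 2 ^ k → h k ≤ g j) →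
  ∑[ k < suc K ] (2 ^ k * h k) ≤ 4 * ∑ ℓ g
∑-doubling-≤ h g zero (suc ℓ) _ h≤g = begin
  1 * h 0 + 0 ≡⟨ +-identityʳ _ ⟩
  1 * h 0     ≤⟨ *-monoʳ-≤ 1 (h≤g 0 0 z≤n z<s z≤n) ⟩
  1 * g 0     ≤⟨ *-mono-≤ {1} {4} (s≤s z≤n) (m≤m+n (g 0) (∑ ℓ (g ∘ suc))) ⟩
  4 * ∑ (suc ℓ) g ∎
  where open ≤-Reasoning
∑-doubling-≤ h g (suc t) ℓ 2^[1+t]<2ℓ h≤g =
  ≤-trans (∑-doubling-block h g t λ k j k≤1+t j<2^t → h≤g k j k≤1+t (<-trans j<2^t 2^t<ℓ))
          (*-monoʳ-≤ 4 (∑-mono-range g (<⇒≤ 2^t<ℓ)))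
  where
  2^t<ℓ : 2 ^ t < ℓ
  2^t<ℓ = *-cancelˡ-< 2 (2 ^ t) ℓ 2^[1+t]<2ℓ

∣p∪q∣≤∣p∣+∣q∣ : ∀ {n} (p q : Subset n) → ∣ p ∪ q ∣ ≤ ∣ p ∣ + ∣ q ∣
∣p∪q∣≤∣p∣+∣q∣ []          []          = z≤n
∣p∪q∣≤∣p∣+∣q∣ (true ∷ p)  (true ∷ q)  = s≤s (≤-trans (∣p∪q∣≤∣p∣+∣q∣ p q) (+-monoʳ-≤ ∣ p ∣ (n≤1+n ∣ q ∣)))
∣p∪q∣≤∣p∣+∣q∣ (true ∷ p)  (false ∷ q) = s≤s (∣p∪q∣≤∣p∣+∣q∣ p q)
∣p∪q∣≤∣p∣+∣q∣ (false ∷ p) (true ∷ q)  = ≤-trans (s≤s (∣p∪q∣≤∣p∣+∣q∣ p q)) (≤-reflexive (sym (+-suc ∣ p ∣ ∣ q ∣)))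
∣p∪q∣≤∣p∣+∣q∣ (false ∷ p) (false ∷ q) = ∣p∪q∣≤∣p∣+∣q∣ p q

∣⋃∣≤sum : ∀ {n} (ps : List (Subset n)) → ∣ ⋃ ps ∣ ≤ sum (map ∣_∣ ps)
∣⋃∣≤sum {n} []       = ≤-reflexive (∣⊥∣≡0 n)
∣⋃∣≤sum     (p ∷ ps) = ≤-trans (∣p∪q∣≤∣p∣+∣q∣ p (⋃ ps)) (+-monoʳ-≤ ∣ p ∣ (∣⋃∣≤sum ps))

sum-map-filter : ∀ {a p} {A : Set a} {P : Pred A p} (P? : Decidable P) (f : A → ℕ) xs →
  sum (map f (filter P? xs)) ≡ sum (map (λ x → if does (P? x) then f x else 0) xs)
sum-map-filter P? f []       = refl
sum-map-filter P? f (x ∷ xs) with does (P? x)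
... | true  = cong (f x +_) (sum-map-filter P? f xs)
... | false = sum-map-filter P? f xs

∣roundedOutput∣≤ : ∀ G ℓ (H : ℕ → Sub G) j →
  ∣ roundedOutput G ℓ H j ∣ ≤ ∑[ k < suc (topExp ℓ) ] (if does (j ≤? 2 ^ k) then ∣ H k ∣ else 0)
∣roundedOutput∣≤ G ℓ H j = begin
  ∣ ⋃ (map H levels) ∣                ≤⟨ ∣⋃∣≤sum (map H levels) ⟩
  sum (map ∣_∣ (map H levels))        ≡⟨ cong sum (sym (map-∘ levels)) ⟩
  sum (map (∣_∣ ∘ H) levels)          ≡⟨ sum-map-filter (λ k → j ≤? 2 ^ k) (∣_∣ ∘ H) (upTo (suc K)) ⟩
  sum (map indicator (upTo (suc K)))  ≡⟨ sum-map-upTo indicator (suc K) ⟩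
  ∑ (suc K) indicator                 ∎
  where
  open ≤-Reasoning
  K = topExp ℓ
  levels = filter (λ k → j ≤? 2 ^ k) (upTo (suc K))
  indicator : ℕ → ℕ
  indicator k = if does (j ≤? 2 ^ k) then ∣ H k ∣ else 0

sparsity-roundedOutput-≤ : ∀ G ℓ (H : ℕ → Sub G) →
  sparsity G ℓ (roundedOutput G ℓ H) ≤ ∑[ k < suc (topExp ℓ) ] (2 ^ k * ∣ H k ∣)
sparsity-roundedOutput-≤ G ℓ H = begin
  sparsity G ℓ (roundedOutput G ℓ H)                   ≡⟨ sum-map-upTo _ ℓ ⟩
  ∑[ j < ℓ ] ∣ roundedOutput G ℓ H (suc j) ∣           ≤⟨ ∑-mono-≤ ℓ (λ j → ∣roundedOutput∣≤ G ℓ H (suc j)) ⟩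
  ∑[ j < ℓ ] ∑[ k < suc K ] counted j k                ≡⟨ ∑-comm ℓ (suc K) counted ⟩
  ∑[ k < suc K ] ∑[ j < ℓ ] counted j k                ≤⟨ ∑-mono-≤ (suc K) (λ k → ∑-indicator-≤ ℓ (2 ^ k) ∣ H k ∣) ⟩
  ∑[ k < suc K ] (2 ^ k * ∣ H k ∣)                     ∎
  where
  open ≤-Reasoning
  K = topExp ℓ
  counted : ℕ → ℕ → ℕ
  counted j k = if does (suc j ≤? 2 ^ k) then ∣ H k ∣ else 0

2^⌈log₂n⌉<2*n : ∀ n .{{_ : NonZero n}} → 2 ^ ⌈log₂ n ⌉ < 2 * n
2^⌈log₂n⌉<2*n n = ≰⇒> λ 2n≤2^⌈log₂n⌉ → 1+n≰n (begin
  suc ⌈log₂ n ⌉           ≡⟨ sym (⌈log₂2*n⌉≡1+⌈log₂n⌉ n) ⟩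
  ⌈log₂ (2 * n) ⌉         ≤⟨ ⌈log₂⌉-mono-≤ 2n≤2^⌈log₂n⌉ ⟩
  ⌈log₂ (2 ^ ⌈log₂ n ⌉) ⌉ ≡⟨ ⌈log₂2^n⌉≡n ⌈log₂ n ⌉ ⟩
  ⌈log₂ n ⌉               ∎)
  where open ≤-Reasoning

module _ {N : ℕ} (S : ℕ → Subset N) where

  nested⇒⊆ : ∀ {ℓ} → (∀ i → 1 ≤ i → i < ℓ → S (suc i) ⊆ S i) →
    ∀ {i} j → 1 ≤ i → i ≤ j → j ≤ ℓ → S j ⊆ S i
  nested⇒⊆ nested j 1≤i i≤j j≤ℓ with m≤n⇒m<n∨m≡n i≤j
  ... | inj₂ refl = λ v∈ → v∈
  nested⇒⊆ nested (suc j) 1≤i _ 1+j≤ℓ | inj₁ (s≤s i≤j) = λ v∈ →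
    nested⇒⊆ nested j 1≤i i≤j (≤-trans (n≤1+n j) 1+j≤ℓ) (nested j (≤-trans 1≤i i≤j) 1+j≤ℓ v∈)

  maxLevel≤ : ∀ i v → maxLevel S i v ≤ i
  maxLevel≤ zero    v = z≤n
  maxLevel≤ (suc i) v with lookup (S (suc i)) v
  ... | true  = ≤-refl
  ... | false = m≤n⇒m≤1+n (maxLevel≤ i v)

  ∈-maxLevel : ∀ i v → 1 ≤ maxLevel S i v → v ∈ S (maxLevel S i v)
  ∈-maxLevel (suc i) v 1≤P with lookup (S (suc i)) v in v∈S[1+i]
  ... | true  = lookup⇒[]= v (S (suc i)) v∈S[1+i]
  ... | false = ∈-maxLevel i v 1≤P

  maxLevel-maximal : ∀ i v {j} → j ≤ i → 1 ≤ j → v ∈ S j → j ≤ maxLevel S i v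
  maxLevel-maximal zero    v z≤n   ()
  maxLevel-maximal (suc i) v j≤1+i 1≤j v∈Sj with lookup (S (suc i)) v in lookup≡b
  ... | true  = j≤1+i
  ... | false with m≤n⇒m<n∨m≡n j≤1+i
  ...   | inj₁ (s≤s j≤i) = maxLevel-maximal i v j≤i 1≤j v∈Sj
  ...   | inj₂ refl      = contradiction (trans (sym ([]=⇒lookup v∈Sj)) lookup≡b) λ ()

  ∈-roundedTerminals : ∀ ℓ k {v} → v ∈ roundedTerminals ℓ S k →
    v ∈ S 1 × 2 ^ k ≤ roundUpPow2 (maxLevel S ℓ v)
  ∈-roundedTerminals ℓ k {v} v∈ =
    lookup⇒[]= v (S 1) (∧-conicalˡ _ _ member) ,
    toWitness {a? = 2 ^ k ≤? _} (Equivalence.from T-≡ (∧-conicalʳ _ _ member))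
    where
    member : lookup (S 1) v ∧ ⌊ 2 ^ k ≤? roundUpPow2 (maxLevel S ℓ v) ⌋ ≡ true
    member = trans (sym (lookup∘tabulate _ v)) ([]=⇒lookup v∈)

  -- 2 * j ≤ 2ᵏ says that the level suc j is at most ⌊2ᵏ/2⌋ + 1.
  roundedTerminals⊆S : ∀ {ℓ} → 1 ≤ ℓ → (∀ i → 1 ≤ i → i < ℓ → S (suc i) ⊆ S i) →
    ∀ k {j} → 2 * j ≤ 2 ^ k → roundedTerminals ℓ S k ⊆ S (suc j)
  roundedTerminals⊆S {ℓ} 1≤ℓ nested k {j} 2j≤2^k {v} v∈ =
    nested⇒⊆ nested P z<s j<P (maxLevel≤ ℓ v) (∈-maxLevel ℓ v 1≤P)
    where
    P = maxLevel S ℓ v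
    v∈S₁ = proj₁ (∈-roundedTerminals ℓ k v∈)
    1≤P : 1 ≤ P
    1≤P = maxLevel-maximal ℓ v 1≤ℓ ≤-refl v∈S₁
    j<P : j < P
    j<P = *-cancelˡ-< 2 j P (begin-strict
      2 * j                 ≤⟨ 2j≤2^k ⟩
      2 ^ k                 ≤⟨ proj₂ (∈-roundedTerminals ℓ k v∈) ⟩
      2 ^ ⌈log₂ P ⌉         <⟨ 2^⌈log₂n⌉<2*n P {{>-nonZero 1≤P}} ⟩
      2 * P                 ∎)
      where open ≤-Reasoning

IsSubsetSpanner-⊆ : ∀ G c {S T} {H : Sub G} → T ⊆ S → IsSubsetSpanner G c S H → IsSubsetSpanner G c T H
IsSubsetSpanner-⊆ G c T⊆S spanner u v u∈T v∈T = spanner u v (T⊆S u∈T) (T⊆S v∈T)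

mainTheorem3 : (G : WGraph) → IsSimple G → PositiveWeights G →
    (ℓ : ℕ) → 1 ≤ ℓ →
    (S : ℕ → Subset (n G)) → NestedTerminals G ℓ S →
    (c : ℚ) → 0ℚ ≤ℚ c →
    (H : ℕ → Sub G) →
    (∀ k → k ≤ topExp ℓ → IsSubsetSpanner G c (roundedTerminals ℓ S k) (H k)) →
    (∀ k → k ≤ topExp ℓ → (H' : Sub G) →
      IsSubsetSpanner G c (roundedTerminals ℓ S k) H' → ∣ H k ∣ ≤ ∣ H' ∣) →
    (Gs : ℕ → Sub G) → IsMultiLevelSpanner G ℓ S c Gs →
    sparsity G ℓ (roundedOutput G ℓ H) ≤ 4 * sparsity G ℓ Gs
mainTheorem3 G _ _ ℓ 1≤ℓ S nested c _ H _ H-minimal Gs (_ , Gs-spanner) = begin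
  sparsity G ℓ (roundedOutput G ℓ H) ≤⟨ sparsity-roundedOutput-≤ G ℓ H ⟩
  ∑[ k < suc K ] (2 ^ k * ∣ H k ∣)   ≤⟨ ∑-doubling-≤ (∣_∣ ∘ H) (∣_∣ ∘ Gs ∘ suc) K ℓ 2^K<2ℓ H≤Gs ⟩
  4 * ∑[ j < ℓ ] ∣ Gs (suc j) ∣      ≡⟨ cong (4 *_) (sym (sum-map-upTo (∣_∣ ∘ Gs ∘ suc) ℓ)) ⟩
  4 * sparsity G ℓ Gs                ∎
  where
  open ≤-Reasoning
  K = topExp ℓ
  2^K<2ℓ : 2 ^ K < 2 * ℓ
  2^K<2ℓ = 2^⌈log₂n⌉<2*n ℓ {{>-nonZero 1≤ℓ}}
  H≤Gs : ∀ k j → k ≤ K → j < ℓ → 2 * j ≤ 2 ^ k → ∣ H k ∣ ≤ ∣ Gs (suc j) ∣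
  H≤Gs k j k≤K j<ℓ 2j≤2^k = H-minimal k k≤K (Gs (suc j))
    (IsSubsetSpanner-⊆ G c (roundedTerminals⊆S S 1≤ℓ nested k 2j≤2^k) (Gs-spanner (suc j) (s≤s z≤n) j<ℓ))
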